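{- Let $h:\mathbb{Z}_{\ge0}\to\mathbb{Z}_{\ge0}$ be nondecreasing and satisfy: for all $z,z'\in\mathbb{Z}_{\ge0}$ and every positive integer $i$, if $\lfloor z/2^i\rfloor=\lfloor z'/2^i\rfloor$ then $\lfloor h(z)/2^{i-1}\rfloor=\lfloor h(z')/2^{i-1}\rfloor$. Let $s$ be a positive integer with $i\oplus s=i+s$ for $i=0,1,\dots,h(s)$. Then for all $y,z\in\mathbb{Z}_{\ge0}$ with $y\le h(z+s)$, $$(y\oplus(z+s))-s=\mathrm{mex}\Big(\{(v\oplus(z+s))-s:v<y\}\cup\{(\min(y,h(w))\oplus w)-s: s\le w<z+s\}\Big).$$
   Context: $\oplus$ denotes nim-sum (bitwise XOR); $v,w$ range over $\mathbb{Z}_{\ge0}$; $\mathrm{mex}(S)$ is the least nonnegative integer not in $S$. -}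

module Defs where

open import Data.Nat using (ℕ; zero; suc; _+_; _*_; _^_; _<_; _≡ᵇ_)
open import Data.Nat.DivMod using (_/_; _%_)
open import Data.Nat.Properties using (m^n≢0)
open import Data.Bool using (if_then_else_)
open import Data.Integer using (ℤ; +_)
open import Data.Product using (_×_)
open import Relation.Nullary using (¬_)

floorDiv2^ : ℕ → ℕ → ℕ
floorDiv2^ z i = _/_ z (2 ^ i) {{m^n≢0 2 i}}

lowBitXor : ℕ → ℕ → ℕ
lowBitXor a b = if (a % 2) ≡ᵇ (b % 2) then 0 else 1

xorFuel : ℕ → ℕ → ℕ → ℕ
xorFuel zero    a b = 0
xorFuel (suc f) a b = lowBitXor a b + 2 * xorFuel f (a / 2) (b / 2)

-- nim-sum a ⊕ b (fuel a + b is at least the bit length of max a b)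
_⊕_ : ℕ → ℕ → ℕ
a ⊕ b = xorFuel (a + b) a b

infixl 6 _⊕_

IsMex : (ℤ → Set) → ℕ → Set
IsMex S m = ¬ S (+ m) × (∀ k → k < m → S (+ k))

-- Write a >> i for ⌊a / 2^i⌋. The hypothesis on h says that h is contracting: if a and b
-- agree above bit i, then h a and h b agree from bit i upwards. The no-carry hypothesis on s
-- yields a power 2^t dividing s and exceeding h s, which gives s ≤ y ⊕ n whenever s ≤ n and
-- y ≤ h n; so it remains to see that y ⊕ n is the mex of the option values before the shift
-- by s. It is not one of them: v ⊕ n = y ⊕ n forces v = y, and if h w < y ≤ h n, then at
-- the highest bit p where w and n differ, h w and h n, hence also y, agree from bit p upwards,
-- so h w ⊕ w = y ⊕ n would make w and n agree at bit p.
-- Conversely let s ≤ x < y ⊕ n, and let p be the highest bit where x and y ⊕ n differ. If n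
-- has bit p clear then v = x ⊕ n < y. Otherwise w₀ = x ⊕ y < n; if y ≤ h w₀ then w₀ realises
-- x, and if not, the contracting map a ↦ x ⊕ h a has a fixed point w agreeing with w₀ from
-- bit p upwards (found bit by bit from the top); this w satisfies s ≤ w < n and h w ≤ y, so
-- that min(y, h w) ⊕ w = h w ⊕ w = x.

module Submission where

open import Defs
open import Data.Nat using (ℕ; zero; suc; _+_; _*_; _∸_; _^_; _≤_; _<_; _≤?_; _<?_; _≟_; _≡ᵇ_; _⊓_; z≤n; s≤s; z<s)
open import Data.Bool using (true; false; if_then_else_)
open import Data.Nat.Properties
open import Data.Nat.DivMod
open import Data.Nat.Induction using (<-rec)
open import Data.Integer using (ℤ; +_; _⊖_)
import Data.Integer as ℤ
open import Data.Integer.Properties using (⊖-≥; +-injective; distribˡ-⊖-+-pos)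
open import Data.Product using (Σ; ∃; _×_; _,_; map₂)
open import Data.Sum using (_⊎_; inj₁; inj₂)
import Data.Sum as Sum
open import Function using (_∘_)
open import Data.Empty using (⊥-elim)
open import Relation.Nullary using (¬_; yes; no)
open import Relation.Binary.PropositionalEquality

-- Nim-sum arithmetic

data Parity : ℕ → Set where
  even : ∀ q → Parity (2 * q)
  odd  : ∀ q → Parity (suc (2 * q))

parity : ∀ n → Parity n
parity zero = even 0
parity (suc n) with parity n
... | even q = odd q
... | odd q = subst Parity (*-suc 2 q) (even (suc q))

even⊎odd : ∀ n → (∃ λ r → n ≡ 2 * r) ⊎ (∃ λ r → n ≡ suc (2 * r))
even⊎odd n with parity n
... | even r = inj₁ (r , refl)
... | odd r = inj₂ (r , refl)

2*n/2≡n : ∀ n → 2 * n / 2 ≡ n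
2*n/2≡n n = trans (cong (_/ 2) (*-comm 2 n)) (m*n/n≡m n 2)

[1+2*n]/2≡n : ∀ n → suc (2 * n) / 2 ≡ n
[1+2*n]/2≡n n = trans (cong (λ m → suc m / 2) (*-comm 2 n))
  (trans (+-distrib-/ 1 (n * 2) (subst (λ r → 1 + r < 2) (sym (m*n%n≡0 n 2)) ≤-refl)) (m*n/n≡m n 2))

2*n%2≡0 : ∀ n → 2 * n % 2 ≡ 0
2*n%2≡0 n = trans (cong (_% 2) (*-comm 2 n)) (m*n%n≡0 n 2)

[1+2*n]%2≡1 : ∀ n → suc (2 * n) % 2 ≡ 1
[1+2*n]%2≡1 n = trans (cong (λ m → suc m % 2) (*-comm 2 n)) ([m+kn]%n≡m%n 1 n 2)

2*m≢1+2*n : ∀ m n → 2 * m ≢ suc (2 * n)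
2*m≢1+2*n m n e with trans (sym (2*n%2≡0 m)) (trans (cong (_% 2) e) ([1+2*n]%2≡1 n))
... | ()

2*[n/2]≤n : ∀ n → 2 * (n / 2) ≤ n
2*[n/2]≤n n = subst (_≤ n) (*-comm (n / 2) 2) (m/n*n≤m n 2)

2*m≤1+n⇒m≤n : ∀ m n → 2 * m ≤ suc n → m ≤ n
2*m≤1+n⇒m≤n m n 2m≤1+n = ≤-pred (*-cancelˡ-< 2 m (suc n) (begin-strict
  2 * m          ≤⟨ 2m≤1+n ⟩
  suc n          <⟨ m<n+m (suc n) z<s ⟩
  suc n + suc n  ≡⟨ cong (λ m → suc n + m) (sym (+-identityʳ (suc n))) ⟩
  2 * suc n      ∎))
  where open ≤-Reasoning

halves-≤ : ∀ x y {a b F} → 2 * x ≤ a → 2 * y ≤ b → a + b ≤ suc F → x + y ≤ F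
halves-≤ x y {F = F} 2x≤a 2y≤b a+b≤1+F = 2*m≤1+n⇒m≤n (x + y) F
  (≤-trans (≤-reflexive (*-distribˡ-+ 2 x y)) (≤-trans (+-mono-≤ 2x≤a 2y≤b) a+b≤1+F))

xorFuel-0-0 : ∀ f → xorFuel f 0 0 ≡ 0
xorFuel-0-0 zero = refl
xorFuel-0-0 (suc f) = cong (2 *_) (xorFuel-0-0 f)

xorFuel-fuel-irrelevant : ∀ f g a b → a + b ≤ f → a + b ≤ g → xorFuel f a b ≡ xorFuel g a b
xorFuel-fuel-irrelevant zero g zero zero _ _ = sym (xorFuel-0-0 g)
xorFuel-fuel-irrelevant zero g zero (suc b) () _
xorFuel-fuel-irrelevant zero g (suc a) b () _
xorFuel-fuel-irrelevant (suc f) zero zero zero _ _ = xorFuel-0-0 (suc f)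
xorFuel-fuel-irrelevant (suc f) zero zero (suc b) _ ()
xorFuel-fuel-irrelevant (suc f) zero (suc a) b _ ()
xorFuel-fuel-irrelevant (suc f) (suc g) a b a+b≤1+f a+b≤1+g = cong (λ r → lowBitXor a b + 2 * r)
  (xorFuel-fuel-irrelevant f g (a / 2) (b / 2) (halves a+b≤1+f) (halves a+b≤1+g))
  where
  halves : ∀ {F} → a + b ≤ suc F → a / 2 + b / 2 ≤ F
  halves = halves-≤ (a / 2) (b / 2) (2*[n/2]≤n a) (2*[n/2]≤n b)

⊕-unfold : ∀ a b → a ⊕ b ≡ lowBitXor a b + 2 * (a / 2 ⊕ b / 2)
⊕-unfold a b = trans
  (xorFuel-fuel-irrelevant (a + b) (suc (a + b)) a b ≤-refl (n≤1+n _))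
  (cong (λ r → lowBitXor a b + 2 * r) (xorFuel-fuel-irrelevant (a + b) (a / 2 + b / 2) (a / 2) (b / 2)
    (+-mono-≤ (m/n≤m a 2) (m/n≤m b 2)) ≤-refl))

even⊕even : ∀ a b → 2 * a ⊕ 2 * b ≡ 2 * (a ⊕ b)
even⊕even a b
  rewrite ⊕-unfold (2 * a) (2 * b) | 2*n%2≡0 a | 2*n%2≡0 b | 2*n/2≡n a | 2*n/2≡n b = refl

even⊕odd : ∀ a b → 2 * a ⊕ suc (2 * b) ≡ suc (2 * (a ⊕ b))
even⊕odd a b
  rewrite ⊕-unfold (2 * a) (suc (2 * b)) | 2*n%2≡0 a | [1+2*n]%2≡1 b | 2*n/2≡n a | [1+2*n]/2≡n b = refl

odd⊕even : ∀ a b → suc (2 * a) ⊕ 2 * b ≡ suc (2 * (a ⊕ b))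
odd⊕even a b
  rewrite ⊕-unfold (suc (2 * a)) (2 * b) | [1+2*n]%2≡1 a | 2*n%2≡0 b | [1+2*n]/2≡n a | 2*n/2≡n b = refl

odd⊕odd : ∀ a b → suc (2 * a) ⊕ suc (2 * b) ≡ 2 * (a ⊕ b)
odd⊕odd a b
  rewrite ⊕-unfold (suc (2 * a)) (suc (2 * b)) | [1+2*n]%2≡1 a | [1+2*n]%2≡1 b | [1+2*n]/2≡n a | [1+2*n]/2≡n b = refl

⊕-half : ∀ a b → (a ⊕ b) / 2 ≡ a / 2 ⊕ b / 2
⊕-half a b = trans (cong (_/ 2) (⊕-unfold a b)) (bit+2*n/2≡n (a % 2 ≡ᵇ b % 2) (a / 2 ⊕ b / 2))
  where
  bit+2*n/2≡n : ∀ c n → ((if c then 0 else 1) + 2 * n) / 2 ≡ n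
  bit+2*n/2≡n true n = 2*n/2≡n n
  bit+2*n/2≡n false n = [1+2*n]/2≡n n

module _ (P : ℕ → ℕ → Set) (P-0-0 : P 0 0)
  (P-2*-2* : ∀ {a b} → P a b → P (2 * a) (2 * b))
  (P-2*-1+2* : ∀ {a b} → P a b → P (2 * a) (suc (2 * b)))
  (P-1+2*-2* : ∀ {a b} → P a b → P (suc (2 * a)) (2 * b))
  (P-1+2*-1+2* : ∀ {a b} → P a b → P (suc (2 * a)) (suc (2 * b))) where

  private
    go : ∀ F a b → a + b ≤ F → P a b
    go zero zero zero _ = P-0-0
    go (suc F) a b a+b≤1+F with parity a | parity b
    ... | even x | even y = P-2*-2* (go F x y (halves-≤ x y ≤-refl ≤-refl a+b≤1+F))
    ... | even x | odd y = P-2*-1+2* (go F x y (halves-≤ x y ≤-refl (n≤1+n _) a+b≤1+F))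
    ... | odd x | even y = P-1+2*-2* (go F x y (halves-≤ x y (n≤1+n _) ≤-refl a+b≤1+F))
    ... | odd x | odd y = P-1+2*-1+2* (go F x y (halves-≤ x y (n≤1+n _) (n≤1+n _) a+b≤1+F))

  binaryInduction₂ : ∀ a b → P a b
  binaryInduction₂ a b = go (a + b) a b ≤-refl

⊕-comm : ∀ a b → a ⊕ b ≡ b ⊕ a
⊕-comm = binaryInduction₂ (λ a b → a ⊕ b ≡ b ⊕ a) refl
  (λ {a} {b} ih → trans (even⊕even a b) (trans (cong (2 *_) ih) (sym (even⊕even b a))))
  (λ {a} {b} ih → trans (even⊕odd a b) (trans (cong (λ r → suc (2 * r)) ih) (sym (odd⊕even b a))))
  (λ {a} {b} ih → trans (odd⊕even a b) (trans (cong (λ r → suc (2 * r)) ih) (sym (even⊕odd b a))))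
  (λ {a} {b} ih → trans (odd⊕odd a b) (trans (cong (2 *_) ih) (sym (odd⊕odd b a))))

⊕-identityˡ : ∀ a → 0 ⊕ a ≡ a
⊕-identityˡ = binaryInduction₂ (λ _ b → 0 ⊕ b ≡ b) refl
  (λ {_} {b} ih → trans (even⊕even 0 b) (cong (2 *_) ih))
  (λ {_} {b} ih → trans (even⊕odd 0 b) (cong (λ r → suc (2 * r)) ih))
  (λ {_} {b} ih → trans (even⊕even 0 b) (cong (2 *_) ih))
  (λ {_} {b} ih → trans (even⊕odd 0 b) (cong (λ r → suc (2 * r)) ih)) 0

⊕-cancelʳ : ∀ a b → (a ⊕ b) ⊕ b ≡ a
⊕-cancelʳ = binaryInduction₂ (λ a b → (a ⊕ b) ⊕ b ≡ a) refl
  (λ {a} {b} ih → trans (cong (_⊕ 2 * b) (even⊕even a b)) (trans (even⊕even (a ⊕ b) b) (cong (2 *_) ih)))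
  (λ {a} {b} ih → trans (cong (_⊕ suc (2 * b)) (even⊕odd a b)) (trans (odd⊕odd (a ⊕ b) b) (cong (2 *_) ih)))
  (λ {a} {b} ih → trans (cong (_⊕ 2 * b) (odd⊕even a b))
                        (trans (odd⊕even (a ⊕ b) b) (cong (λ r → suc (2 * r)) ih)))
  (λ {a} {b} ih → trans (cong (_⊕ suc (2 * b)) (odd⊕odd a b))
                        (trans (even⊕odd (a ⊕ b) b) (cong (λ r → suc (2 * r)) ih)))

⊕-cancelˡ : ∀ a b → a ⊕ (b ⊕ a) ≡ b
⊕-cancelˡ a b = trans (⊕-comm a (b ⊕ a)) (⊕-cancelʳ b a)

⊕-injectiveʳ : ∀ c {a b} → a ⊕ c ≡ b ⊕ c → a ≡ b
⊕-injectiveʳ c {a} {b} eq = begin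
  a            ≡⟨ sym (⊕-cancelʳ a c) ⟩
  (a ⊕ c) ⊕ c  ≡⟨ cong (_⊕ c) eq ⟩
  (b ⊕ c) ⊕ c  ≡⟨ ⊕-cancelʳ b c ⟩
  b            ∎
  where open ≡-Reasoning

⊕-injectiveˡ : ∀ c {a b} → c ⊕ a ≡ c ⊕ b → a ≡ b
⊕-injectiveˡ c {a} {b} eq = ⊕-injectiveʳ c (trans (⊕-comm a c) (trans eq (⊕-comm c b)))

-- Shifts and the highest differing bit

infixl 7 _>>_

_>>_ : ℕ → ℕ → ℕ
a >> zero = a
a >> suc i = (a / 2) >> i

floorDiv2^≡>> : ∀ a i → floorDiv2^ a i ≡ a >> i
floorDiv2^≡>> a zero = n/1≡n a
floorDiv2^≡>> a (suc i) = trans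
  (sym (m/n/o≡m/[n*o] a 2 (2 ^ i) {{_}} {{m^n≢0 2 i}} {{m^n≢0 2 (suc i)}}))
  (floorDiv2^≡>> (a / 2) i)

>>-suc : ∀ a i → a >> suc i ≡ (a >> i) / 2
>>-suc a zero = refl
>>-suc a (suc i) = >>-suc (a / 2) i

>>-+ : ∀ a i j → a >> (i + j) ≡ a >> i >> j
>>-+ a zero j = refl
>>-+ a (suc i) j = >>-+ (a / 2) i j

0>>i≡0 : ∀ i → 0 >> i ≡ 0
0>>i≡0 zero = refl
0>>i≡0 (suc i) = 0>>i≡0 i

>>-monoˡ-≤ : ∀ i {a b} → a ≤ b → a >> i ≤ b >> i
>>-monoˡ-≤ zero a≤b = a≤b
>>-monoˡ-≤ (suc i) a≤b = >>-monoˡ-≤ i (/-monoˡ-≤ 2 a≤b)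

>>-cancelˡ-< : ∀ i {a b} → a >> i < b >> i → a < b
>>-cancelˡ-< i {a} {b} a>>i<b>>i with a <? b
... | yes a<b = a<b
... | no a≮b = ⊥-elim (<⇒≱ a>>i<b>>i (>>-monoˡ-≤ i (≮⇒≥ a≮b)))

2^i*[a>>i]≤a : ∀ i a → 2 ^ i * (a >> i) ≤ a
2^i*[a>>i]≤a zero a = ≤-reflexive (+-identityʳ a)
2^i*[a>>i]≤a (suc i) a = begin
  2 * 2 ^ i * (a / 2 >> i)    ≡⟨ *-assoc 2 (2 ^ i) (a / 2 >> i) ⟩
  2 * (2 ^ i * (a / 2 >> i))  ≤⟨ *-monoʳ-≤ 2 (2^i*[a>>i]≤a i (a / 2)) ⟩
  2 * (a / 2)                 ≤⟨ 2*[n/2]≤n a ⟩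
  a                           ∎
  where open ≤-Reasoning

>>-⊕ : ∀ i a b → (a ⊕ b) >> i ≡ a >> i ⊕ b >> i
>>-⊕ zero a b = refl
>>-⊕ (suc i) a b = trans (cong (_>> i) (⊕-half a b)) (>>-⊕ i (a / 2) (b / 2))

>>-squeeze : ∀ i {a b c} → a ≤ b → b ≤ c → a >> i ≡ c >> i → b >> i ≡ a >> i
>>-squeeze i a≤b b≤c a≡c =
  ≤-antisym (≤-trans (>>-monoˡ-≤ i b≤c) (≤-reflexive (sym a≡c))) (>>-monoˡ-≤ i a≤b)

>>≡0-mono : ∀ {a i j} → a >> i ≡ 0 → i ≤ j → a >> j ≡ 0
>>≡0-mono {a} {i} {j} a>>i≡0 i≤j = begin
  a >> j              ≡⟨ cong (a >>_) (sym (m+[n∸m]≡n i≤j)) ⟩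
  a >> (i + (j ∸ i))  ≡⟨ >>-+ a i (j ∸ i) ⟩
  a >> i >> (j ∸ i)   ≡⟨ cong (_>> (j ∸ i)) a>>i≡0 ⟩
  0 >> (j ∸ i)        ≡⟨ 0>>i≡0 (j ∸ i) ⟩
  0                   ∎
  where open ≡-Reasoning

>>-⊕-vanishing : ∀ i {u} a → u >> i ≡ 0 → (u ⊕ a) >> i ≡ a >> i
>>-⊕-vanishing i {u} a u>>i≡0 =
  trans (>>-⊕ i u a) (trans (cong (_⊕ a >> i) u>>i≡0) (⊕-identityˡ (a >> i)))

record DifferAt (p a b : ℕ) : Set where
  constructor differAt
  field
    q : ℕ
    lower : a >> p ≡ 2 * q
    upper : b >> p ≡ suc (2 * q)

module _ {p a b : ℕ} (d : DifferAt p a b) where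
  open DifferAt d

  DifferAt⇒agreeAbove : a >> suc p ≡ b >> suc p
  DifferAt⇒agreeAbove = begin
    a >> suc p           ≡⟨ >>-suc a p ⟩
    a >> p / 2           ≡⟨ cong (_/ 2) lower ⟩
    2 * q / 2            ≡⟨ 2*n/2≡n q ⟩
    q                    ≡⟨ sym ([1+2*n]/2≡n q) ⟩
    suc (2 * q) / 2      ≡⟨ cong (_/ 2) (sym upper) ⟩
    b >> p / 2           ≡⟨ sym (>>-suc b p) ⟩
    b >> suc p           ∎
    where open ≡-Reasoning

  DifferAt⇒>>-< : a >> p < b >> p
  DifferAt⇒>>-< = subst₂ _<_ (sym lower) (sym upper) ≤-refl

  DifferAt⇒< : a < b
  DifferAt⇒< = >>-cancelˡ-< p DifferAt⇒>>-<

  DifferAt⇒>>-≢ : a >> p ≢ b >> p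
  DifferAt⇒>>-≢ eq = 2*m≢1+2*n q q (trans (sym lower) (trans eq upper))

  DifferAt-⊕-even : ∀ {c} r → c >> p ≡ 2 * r → DifferAt p (a ⊕ c) (b ⊕ c)
  DifferAt-⊕-even {c} r c≡2r = differAt (q ⊕ r)
    (trans (>>-⊕ p a c) (trans (cong₂ _⊕_ lower c≡2r) (even⊕even q r)))
    (trans (>>-⊕ p b c) (trans (cong₂ _⊕_ upper c≡2r) (odd⊕even q r)))

  DifferAt-⊕-odd : ∀ {c} r → c >> p ≡ suc (2 * r) → DifferAt p (b ⊕ c) (a ⊕ c)
  DifferAt-⊕-odd {c} r c≡1+2r = differAt (q ⊕ r)
    (trans (>>-⊕ p b c) (trans (cong₂ _⊕_ upper c≡1+2r) (odd⊕odd q r)))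
    (trans (>>-⊕ p a c) (trans (cong₂ _⊕_ lower c≡1+2r) (even⊕odd q r)))

DifferAt-shift : ∀ {i j a b} → DifferAt j (a >> i) (b >> i) → DifferAt (i + j) a b
DifferAt-shift {i} {j} {a} {b} (differAt q lower upper) =
  differAt q (trans (>>-+ a i j) lower) (trans (>>-+ b i j) upper)

DifferAt-⊕-cancel-even : ∀ {p x y n} → DifferAt p x (y ⊕ n) → ∀ r → n >> p ≡ 2 * r
  → DifferAt p (x ⊕ n) y
DifferAt-⊕-cancel-even {p} {x} {y} {n} d r n>>p≡2r =
  subst (DifferAt p (x ⊕ n)) (⊕-cancelʳ y n) (DifferAt-⊕-even d r n>>p≡2r)

DifferAt-⊕-cancel-odd : ∀ {p x y n} → DifferAt p x (y ⊕ n) → ∀ r → n >> p ≡ suc (2 * r)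
  → DifferAt p (x ⊕ y) n
DifferAt-⊕-cancel-odd {p} {x} {y} {n} d r n>>p≡1+2r =
  subst (DifferAt p (x ⊕ y)) y⊕n⊕y≡n (DifferAt-⊕-even d (DifferAt.q y-below) (DifferAt.lower y-below))
  where
  y-below : DifferAt p y (x ⊕ n)
  y-below = subst (λ a → DifferAt p a (x ⊕ n)) (⊕-cancelʳ y n) (DifferAt-⊕-odd d r n>>p≡1+2r)
  y⊕n⊕y≡n : (y ⊕ n) ⊕ y ≡ n
  y⊕n⊕y≡n = trans (cong (_⊕ y) (⊕-comm y n)) (⊕-cancelʳ n y)

sameHalf⇒DifferAt0 : ∀ {a b} → a < b → a / 2 ≡ b / 2 → DifferAt 0 a b
sameHalf⇒DifferAt0 = go (parity _) (parity _)
  where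
  same : ∀ {u v x y : ℕ} → u ≡ v → u ≡ x → v ≡ y → x ≡ y
  same u≡v u≡x v≡y = trans (sym u≡x) (trans u≡v v≡y)

  go : ∀ {a b} → Parity a → Parity b → a < b → a / 2 ≡ b / 2 → DifferAt 0 a b
  go (even x) (even y) a<b eq with same eq (2*n/2≡n x) (2*n/2≡n y)
  ... | refl = ⊥-elim (<-irrefl refl a<b)
  go (even x) (odd y) a<b eq with same eq (2*n/2≡n x) ([1+2*n]/2≡n y)
  ... | refl = differAt x refl refl
  go (odd x) (even y) a<b eq with same eq ([1+2*n]/2≡n x) (2*n/2≡n y)
  ... | refl = ⊥-elim (<-asym a<b ≤-refl)
  go (odd x) (odd y) a<b eq with same eq ([1+2*n]/2≡n x) ([1+2*n]/2≡n y)
  ... | refl = ⊥-elim (<-irrefl refl a<b)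

<⇒DifferAt : ∀ {a b} → a < b → ∃ λ p → DifferAt p a b
<⇒DifferAt {b = b} = <-rec (λ b → ∀ {a} → a < b → ∃ λ p → DifferAt p a b) step b
  where
  step : ∀ b → (∀ {b′} → b′ < b → ∀ {a} → a < b′ → ∃ λ p → DifferAt p a b′)
    → ∀ {a} → a < b → ∃ λ p → DifferAt p a b
  step b@(suc _) rec {a} a<b with a / 2 ≟ b / 2
  ... | yes a/2≡b/2 = 0 , sameHalf⇒DifferAt0 a<b a/2≡b/2
  ... | no a/2≢b/2 with rec (m/n<m b 2 ≤-refl) (≤∧≢⇒< (/-monoˡ-≤ 2 (<⇒≤ a<b)) a/2≢b/2)
  ...   | p , differAt q lower upper = suc p , differAt q lower upper

-- Contracting maps and the mex

Contracting : (ℕ → ℕ) → Set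
Contracting f = ∀ a b i → a >> suc i ≡ b >> suc i → f a >> i ≡ f b >> i

Contracting-floorDiv2^ : ∀ {f}
  → (∀ a b i → floorDiv2^ a (suc i) ≡ floorDiv2^ b (suc i) → floorDiv2^ (f a) i ≡ floorDiv2^ (f b) i)
  → Contracting f
Contracting-floorDiv2^ {f} contr a b i agree = begin
  f a >> i            ≡⟨ sym (floorDiv2^≡>> (f a) i) ⟩
  floorDiv2^ (f a) i  ≡⟨ contr a b i agree′ ⟩
  floorDiv2^ (f b) i  ≡⟨ floorDiv2^≡>> (f b) i ⟩
  f b >> i            ∎
  where
  open ≡-Reasoning
  agree′ : floorDiv2^ a (suc i) ≡ floorDiv2^ b (suc i)
  agree′ = trans (floorDiv2^≡>> a (suc i)) (trans agree (sym (floorDiv2^≡>> b (suc i))))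

⊕-contracting : ∀ x {f} → Contracting f → Contracting (λ a → x ⊕ f a)
⊕-contracting x {f} f-contracting a b i agree = begin
  (x ⊕ f a) >> i      ≡⟨ >>-⊕ i x (f a) ⟩
  x >> i ⊕ f a >> i   ≡⟨ cong (x >> i ⊕_) (f-contracting a b i agree) ⟩
  x >> i ⊕ f b >> i   ≡⟨ sym (>>-⊕ i x (f b)) ⟩
  (x ⊕ f b) >> i      ∎
  where open ≡-Reasoning

contracting-fixedPoint : ∀ {f} → Contracting f → ∀ i a → a >> i ≡ f a >> i
  → ∃ λ w → f w ≡ w × w >> i ≡ a >> i
contracting-fixedPoint f-contr zero a a≡fa = a , sym a≡fa , refl
contracting-fixedPoint {f} f-contr (suc i) a a≡fa
  with contracting-fixedPoint f-contr i (f a) (f-contr a (f a) i a≡fa)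
... | w , fw≡w , w≡fa = w , fw≡w , (begin
  w >> suc i      ≡⟨ >>-suc w i ⟩
  w >> i / 2      ≡⟨ cong (_/ 2) w≡fa ⟩
  f a >> i / 2    ≡⟨ sym (>>-suc (f a) i) ⟩
  f a >> suc i    ≡⟨ sym a≡fa ⟩
  a >> suc i      ∎)
  where open ≡-Reasoning

NoCarry : ℕ → ℕ → Set
NoCarry K s = ∀ i → i ≤ K → i ⊕ s ≡ i + s

SeparatingPower : ℕ → ℕ → Set
SeparatingPower K s = ∃ λ t → K >> t ≡ 0 × 2 ^ t * (s >> t) ≡ s

noCarry⇒separatingPower : ∀ K s → NoCarry K s → SeparatingPower K s
noCarry⇒separatingPower = <-rec _ step
  where
  step : ∀ K → (∀ {K′} → K′ < K → ∀ s → NoCarry K′ s → SeparatingPower K′ s)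
    → ∀ s → NoCarry K s → SeparatingPower K s
  step zero rec s noCarry = 0 , refl , +-identityʳ s
  step K@(suc _) rec s noCarry with parity s
  ... | odd q = ⊥-elim (<-irrefl (begin
    2 * q              ≡⟨ cong (2 *_) (sym (⊕-identityˡ q)) ⟩
    2 * (0 ⊕ q)        ≡⟨ sym (odd⊕odd 0 q) ⟩
    1 ⊕ suc (2 * q)    ≡⟨ noCarry 1 (s≤s z≤n) ⟩
    2 + 2 * q          ∎) (m<n+m (2 * q) {2} z<s))
    where open ≡-Reasoning
  ... | even q with rec (m/n<m K 2 ≤-refl) q noCarry/2
    where
    noCarry/2 : NoCarry (K / 2) q
    noCarry/2 i i≤K/2 = *-cancelˡ-≡ (i ⊕ q) (i + q) 2 (begin
      2 * (i ⊕ q)      ≡⟨ sym (even⊕even i q) ⟩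
      2 * i ⊕ 2 * q    ≡⟨ noCarry (2 * i) (≤-trans (*-monoʳ-≤ 2 i≤K/2) (2*[n/2]≤n K)) ⟩
      2 * i + 2 * q    ≡⟨ sym (*-distribˡ-+ 2 i q) ⟩
      2 * (i + q)      ∎)
      where open ≡-Reasoning
  ...   | t , K>>t≡0 , q-aligned = suc t , K>>t≡0 , (begin
    2 * 2 ^ t * (2 * q / 2 >> t)   ≡⟨ cong (λ r → 2 * 2 ^ t * (r >> t)) (2*n/2≡n q) ⟩
    2 * 2 ^ t * (q >> t)           ≡⟨ *-assoc 2 (2 ^ t) (q >> t) ⟩
    2 * (2 ^ t * (q >> t))         ≡⟨ cong (2 *_) q-aligned ⟩
    2 * q                          ∎)
    where open ≡-Reasoning

[m+n]⊖n≡m : ∀ m n → (m + n) ⊖ n ≡ + m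
[m+n]⊖n≡m m n = trans (⊖-≥ (m≤n+m n m)) (cong +_ (m+n∸n≡m m n))

⊖-cancelʳ : ∀ s {a b} → a ⊖ s ≡ b ⊖ s → a ≡ b
⊖-cancelʳ s {a} {b} eq = +-injective (begin
  + a              ≡⟨ sym ([m+n]⊖n≡m a s) ⟩
  (a + s) ⊖ s      ≡⟨ sym (distribˡ-⊖-+-pos s a s) ⟩
  a ⊖ s ℤ.+ + s    ≡⟨ cong (ℤ._+ + s) eq ⟩
  b ⊖ s ℤ.+ + s    ≡⟨ distribˡ-⊖-+-pos s b s ⟩
  (b + s) ⊖ s      ≡⟨ [m+n]⊖n≡m b s ⟩
  + b              ∎)
  where open ≡-Reasoning

module Mex (h : ℕ → ℕ) (h-mono : ∀ a b → a ≤ b → h a ≤ h b) (h-contracting : Contracting h)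
  (s t : ℕ) (h[s]>>t≡0 : h s >> t ≡ 0) (s-aligned : 2 ^ t * (s >> t) ≡ s) where

  s≤-by->>t : ∀ {a} → s >> t ≤ a >> t → s ≤ a
  s≤-by->>t {a} le = begin
    s                  ≡⟨ sym s-aligned ⟩
    2 ^ t * (s >> t)   ≤⟨ *-monoʳ-≤ (2 ^ t) le ⟩
    2 ^ t * (a >> t)   ≤⟨ 2^i*[a>>i]≤a t a ⟩
    a                  ∎
    where open ≤-Reasoning

  ≤h⇒>>≡0 : ∀ {y n L} → y ≤ h n → t ≤ L → n >> suc L ≡ s >> suc L → y >> L ≡ 0
  ≤h⇒>>≡0 {y} {n} {L} y≤hn t≤L agree = n≤0⇒n≡0 (begin
    y >> L     ≤⟨ >>-monoˡ-≤ L y≤hn ⟩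
    h n >> L   ≡⟨ h-contracting n s L agree ⟩
    h s >> L   ≡⟨ >>≡0-mono h[s]>>t≡0 t≤L ⟩
    0          ∎)
    where open ≤-Reasoning

  s≤x⊕u : ∀ {x u} → s ≤ x → u ≤ h s → s ≤ x ⊕ u
  s≤x⊕u {x} {u} s≤x u≤hs = s≤-by->>t (begin
    s >> t          ≤⟨ >>-monoˡ-≤ t s≤x ⟩
    x >> t          ≡⟨ sym (>>-⊕-vanishing t x (≤h⇒>>≡0 u≤hs ≤-refl refl)) ⟩
    (u ⊕ x) >> t    ≡⟨ cong (_>> t) (⊕-comm u x) ⟩
    (x ⊕ u) >> t    ∎)
    where open ≤-Reasoning

  s≤x⊕u-unless : ∀ {x u} → s ≤ x → (x ⊕ u < s → u ≤ h s) → s ≤ x ⊕ u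
  s≤x⊕u-unless {x} {u} s≤x small with s ≤? x ⊕ u
  ... | yes s≤x⊕u′ = s≤x⊕u′
  ... | no s≰x⊕u = s≤x⊕u s≤x (small (≰⇒> s≰x⊕u))

  s≤y⊕n : ∀ {y n} → s ≤ n → y ≤ h n → s ≤ y ⊕ n
  s≤y⊕n {y} {n} s≤n y≤hn with n >> suc t ≟ s >> suc t
  ... | yes agree = s≤-by->>t (begin
    s >> t         ≤⟨ >>-monoˡ-≤ t s≤n ⟩
    n >> t         ≡⟨ sym (>>-⊕-vanishing t {y} n (≤h⇒>>≡0 y≤hn ≤-refl agree)) ⟩
    (y ⊕ n) >> t   ∎)
    where open ≤-Reasoning
  ... | no disagree with <⇒DifferAt (≤∧≢⇒< (>>-monoˡ-≤ (suc t) s≤n) (≢-sym disagree))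
  ...   | j , d = <⇒≤ (>>-cancelˡ-< L (begin-strict
    s >> L         <⟨ DifferAt⇒>>-< d′ ⟩
    n >> L         ≡⟨ sym (>>-⊕-vanishing L {y} n y>>L≡0) ⟩
    (y ⊕ n) >> L   ∎))
    where
    open ≤-Reasoning
    L = suc t + j
    d′ : DifferAt L s n
    d′ = DifferAt-shift d
    y>>L≡0 : y >> L ≡ 0
    y>>L≡0 = ≤h⇒>>≡0 y≤hn (m≤n⇒m≤1+n (m≤m+n t j)) (sym (DifferAt⇒agreeAbove d′))

  Option₁ Option₂ Option : ℕ → ℕ → ℕ → Set
  Option₁ y n x = ∃ λ v → v < y × v ⊕ n ≡ x
  Option₂ y n x = ∃ λ w → s ≤ w × w < n × (y ⊓ h w) ⊕ w ≡ x
  Option y n x = Option₁ y n x ⊎ Option₂ y n x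

  h-agreeBelow : ∀ {p w n} → DifferAt p w n → h w >> p ≡ h n >> p
  h-agreeBelow {p} {w} {n} d = h-contracting w n p (DifferAt⇒agreeAbove d)

  h[w]⊕w≢y⊕n : ∀ {w y n} → w < n → h w < y → y ≤ h n → h w ⊕ w ≢ y ⊕ n
  h[w]⊕w≢y⊕n {w} {y} {n} w<n hw<y y≤hn eq with <⇒DifferAt w<n
  ... | p , d = DifferAt⇒>>-≢ d (⊕-injectiveˡ (y >> p) (begin
    y >> p ⊕ w >> p      ≡⟨ cong (_⊕ w >> p) y>>p≡hw>>p ⟩
    h w >> p ⊕ w >> p    ≡⟨ sym (>>-⊕ p (h w) w) ⟩
    (h w ⊕ w) >> p       ≡⟨ cong (_>> p) eq ⟩
    (y ⊕ n) >> p         ≡⟨ >>-⊕ p y n ⟩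
    y >> p ⊕ n >> p      ∎))
    where
    open ≡-Reasoning
    y>>p≡hw>>p : y >> p ≡ h w >> p
    y>>p≡hw>>p = >>-squeeze p (<⇒≤ hw<y) y≤hn (h-agreeBelow d)

  y⊕n-notOption : ∀ {y n} → y ≤ h n → ¬ Option y n (y ⊕ n)
  y⊕n-notOption {n = n} y≤hn (inj₁ (v , v<y , eq)) = <-irrefl (⊕-injectiveʳ n eq) v<y
  y⊕n-notOption {y} y≤hn (inj₂ (w , s≤w , w<n , eq)) with y ≤? h w
  ... | yes y≤hw = <-irrefl (⊕-injectiveˡ y (trans (cong (_⊕ w) (sym (m≤n⇒m⊓n≡m y≤hw))) eq)) w<n
  ... | no y≰hw = h[w]⊕w≢y⊕n w<n hw<y y≤hn (trans (cong (_⊕ w) (sym (m≥n⇒m⊓n≡n (<⇒≤ hw<y)))) eq)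
    where
    hw<y : h w < y
    hw<y = ≰⇒> y≰hw

  h-fixedPoint-≤ : ∀ x {y w} → x ⊕ h w ≡ w → h (x ⊕ y) ≤ y → h w ≤ y
  h-fixedPoint-≤ x {y} {w} fixed h[x⊕y]≤y with h w ≤? y
  ... | yes hw≤y = hw≤y
  ... | no hw≰y with <⇒DifferAt (≰⇒> hw≰y)
  ...   | j , d = ⊥-elim (<⇒≱ (DifferAt⇒>>-< d) (begin
    h w >> j          ≡⟨ h-contracting w (x ⊕ y) j w-agree ⟩
    h (x ⊕ y) >> j    ≤⟨ >>-monoˡ-≤ j h[x⊕y]≤y ⟩
    y >> j            ∎))
    where
    open ≤-Reasoning
    w-agree : w >> suc j ≡ (x ⊕ y) >> suc j
    w-agree = begin-equality
      w >> suc j                    ≡⟨ cong (_>> suc j) (sym fixed) ⟩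
      (x ⊕ h w) >> suc j            ≡⟨ >>-⊕ (suc j) x (h w) ⟩
      x >> suc j ⊕ h w >> suc j     ≡⟨ cong (x >> suc j ⊕_) (sym (DifferAt⇒agreeAbove d)) ⟩
      x >> suc j ⊕ y >> suc j       ≡⟨ sym (>>-⊕ (suc j) x y) ⟩
      (x ⊕ y) >> suc j              ∎

  option₂-at-x⊕y : ∀ {p x y n} → s ≤ x → DifferAt p (x ⊕ y) n → y ≤ h (x ⊕ y) → Option₂ y n x
  option₂-at-x⊕y {x = x} {y} s≤x d y≤hw₀ = x ⊕ y , s≤w₀ , DifferAt⇒< d , (begin
    (y ⊓ h (x ⊕ y)) ⊕ (x ⊕ y)   ≡⟨ cong (_⊕ (x ⊕ y)) (m≤n⇒m⊓n≡m y≤hw₀) ⟩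
    y ⊕ (x ⊕ y)                 ≡⟨ ⊕-cancelˡ y x ⟩
    x                           ∎)
    where
    open ≡-Reasoning
    s≤w₀ : s ≤ x ⊕ y
    s≤w₀ = s≤x⊕u-unless s≤x (λ w₀<s → ≤-trans y≤hw₀ (h-mono _ _ (<⇒≤ w₀<s)))

  option₂-at-fixedPoint : ∀ {p x y n} → y ≤ h n → s ≤ x → DifferAt p (x ⊕ y) n → h (x ⊕ y) < y
    → Option₂ y n x
  option₂-at-fixedPoint {p} {x} {y} {n} y≤hn s≤x d hw₀<y
    with contracting-fixedPoint (⊕-contracting x h-contracting) p (x ⊕ y) start
    where
    open ≡-Reasoning
    start : (x ⊕ y) >> p ≡ (x ⊕ h (x ⊕ y)) >> p
    start = begin
      (x ⊕ y) >> p              ≡⟨ >>-⊕ p x y ⟩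
      x >> p ⊕ y >> p           ≡⟨ cong (x >> p ⊕_) (>>-squeeze p (<⇒≤ hw₀<y) y≤hn (h-agreeBelow d)) ⟩
      x >> p ⊕ h (x ⊕ y) >> p   ≡⟨ sym (>>-⊕ p x (h (x ⊕ y))) ⟩
      (x ⊕ h (x ⊕ y)) >> p      ∎
  ... | w , fixed , w>>p≡w₀>>p = w , s≤w , w<n , (begin
    (y ⊓ h w) ⊕ w        ≡⟨ cong (_⊕ w) (m≥n⇒m⊓n≡n (h-fixedPoint-≤ x fixed (<⇒≤ hw₀<y))) ⟩
    h w ⊕ w              ≡⟨ cong (h w ⊕_) (sym fixed) ⟩
    h w ⊕ (x ⊕ h w)      ≡⟨ ⊕-cancelˡ (h w) x ⟩
    x                    ∎)
    where
    open ≡-Reasoning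
    w<n : w < n
    w<n = >>-cancelˡ-< p (subst (_< n >> p) (sym w>>p≡w₀>>p) (DifferAt⇒>>-< d))
    s≤w : s ≤ w
    s≤w = subst (s ≤_) fixed (s≤x⊕u-unless s≤x λ x⊕hw<s →
      h-mono _ _ (<⇒≤ (subst (_< s) fixed x⊕hw<s)))

  option₂ : ∀ {p x y n} → y ≤ h n → s ≤ x → DifferAt p (x ⊕ y) n → Option₂ y n x
  option₂ {x = x} {y} y≤hn s≤x d with y ≤? h (x ⊕ y)
  ... | yes y≤hw₀ = option₂-at-x⊕y s≤x d y≤hw₀
  ... | no y≰hw₀ = option₂-at-fixedPoint y≤hn s≤x d (≰⇒> y≰hw₀)

  option-below : ∀ {x y n} → y ≤ h n → s ≤ x → x < y ⊕ n → Option y n x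
  option-below {x} {y} {n} y≤hn s≤x x<y⊕n with <⇒DifferAt x<y⊕n
  ... | p , d with even⊎odd (n >> p)
  ...   | inj₁ (r , n>>p≡2r) =
    inj₁ (x ⊕ n , DifferAt⇒< (DifferAt-⊕-cancel-even d r n>>p≡2r) , ⊕-cancelʳ x n)
  ...   | inj₂ (r , n>>p≡1+2r) = inj₂ (option₂ y≤hn s≤x (DifferAt-⊕-cancel-odd d r n>>p≡1+2r))

  OptionValue : ℕ → ℕ → ℤ → Set
  OptionValue y n x = (∃ λ v → v < y × x ≡ (v ⊕ n) ⊖ s)
                    ⊎ (∃ λ w → s ≤ w × w < n × x ≡ ((y ⊓ h w) ⊕ w) ⊖ s)

  option⇒value : ∀ {y n x} → Option y n x → OptionValue y n (x ⊖ s)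
  option⇒value = Sum.map (map₂ (map₂ (cong (_⊖ s) ∘ sym))) (map₂ (map₂ (map₂ (cong (_⊖ s) ∘ sym))))

  value⇒option : ∀ {y n x} → OptionValue y n (x ⊖ s) → Option y n x
  value⇒option = Sum.map (map₂ (map₂ (sym ∘ ⊖-cancelʳ s))) (map₂ (map₂ (map₂ (sym ∘ ⊖-cancelʳ s))))

  mex : ∀ {y n} → s ≤ n → y ≤ h n → Σ ℕ λ m → (+ m ≡ (y ⊕ n) ⊖ s) × IsMex (OptionValue y n) m
  mex {y} {n} s≤n y≤hn = (y ⊕ n) ∸ s , sym y⊕n⊖s , y⊕n-notValue , below-values
    where
    s≤y⊕n′ : s ≤ y ⊕ n
    s≤y⊕n′ = s≤y⊕n s≤n y≤hn
    y⊕n⊖s : (y ⊕ n) ⊖ s ≡ + ((y ⊕ n) ∸ s)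
    y⊕n⊖s = ⊖-≥ s≤y⊕n′
    y⊕n-notValue : ¬ OptionValue y n (+ ((y ⊕ n) ∸ s))
    y⊕n-notValue = y⊕n-notOption y≤hn ∘ value⇒option ∘ subst (OptionValue y n) (sym y⊕n⊖s)
    below-values : ∀ k → k < (y ⊕ n) ∸ s → OptionValue y n (+ k)
    below-values k k<m =
      subst (OptionValue y n) ([m+n]⊖n≡m k s) (option⇒value (option-below y≤hn (m≤n+m s k) k+s<y⊕n))
      where
      k+s<y⊕n : k + s < y ⊕ n
      k+s<y⊕n = subst (k + s <_) (m∸n+n≡m s≤y⊕n′) (+-monoˡ-< s k<m)

mainTheorem19 : (h : ℕ → ℕ)
    → (∀ a b → a ≤ b → h a ≤ h b)
    → (∀ z z′ i → floorDiv2^ z (suc i) ≡ floorDiv2^ z′ (suc i)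
         → floorDiv2^ (h z) i ≡ floorDiv2^ (h z′) i)
    → (s : ℕ) → 0 < s
    → (∀ i → i ≤ h s → i ⊕ s ≡ i + s)
    → ∀ y z → y ≤ h (z + s)
    → Σ ℕ λ m → (+ m ≡ (y ⊕ (z + s)) ⊖ s)
        × IsMex (λ x → (∃ λ v → v < y × x ≡ (v ⊕ (z + s)) ⊖ s)
                     ⊎ (∃ λ w → s ≤ w × w < z + s × x ≡ ((y ⊓ h w) ⊕ w) ⊖ s)) m
mainTheorem19 h h-mono h-contracting s _ noCarry y z y≤h[z+s]
  with noCarry⇒separatingPower (h s) s noCarry
... | t , h[s]>>t≡0 , s-aligned =
  Mex.mex h h-mono (Contracting-floorDiv2^ h-contracting) s t h[s]>>t≡0 s-aligned (m≤n+m s z) y≤h[z+s]
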